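{- Let $G$ be a graph and $\ell\ge 2$. Then $\overline{G\cup K_1}$ is $N$-AW if and only if $G$ is $A$-AW.
   Context: All graphs are finite and simple; labels lie in $\mathbb{Z}_\ell$. For a square matrix $M=[m_{ij}]$ over $\mathbb{Z}_\ell$ indexed by a vertex set $\{v_1,\dots,v_n\}$, the $M$-Lights Out game is: each vertex carries a label in $\mathbb{Z}_\ell$; toggling $v_j$ adds $m_{ij}$ to the label of $v_i$ for every $i$; the game is won when all labels are $0$. A graph $G$ is $N$-AW if the $N(G)$-Lights Out game can be won from every initial labeling, where $N(G)$ is the neighborhood matrix ($1$ on the diagonal and for adjacent pairs, $0$ otherwise); $G$ is $A$-AW if the same holds for the adjacency matrix $A(G)$ (toggling a vertex adds $1$ to the labels of its neighbors only). $G\cup K_1$ is $G$ with an added isolated vertex and $\overline{\,\cdot\,}$ denotes complement. -}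

module Defs where

open import Data.Nat using (ℕ; zero; suc; _+_; _*_)
open import Data.Nat.Divisibility using (_∣_)
open import Data.Fin using (Fin; zero; suc; toℕ; _≟_)
open import Data.Bool using (Bool; true; false; not; _∧_; if_then_else_)
open import Data.Product using (Σ; ∃)
open import Relation.Binary.PropositionalEquality using (_≡_)
open import Relation.Nullary.Decidable using (⌊_⌋; yes; no)
open import Relation.Binary.PropositionalEquality using (cong₂; refl) renaming (sym to ≡-sym)
open import Data.Empty using (⊥-elim)

record Graph : Set where
  field
    n     : ℕ
    adj   : Fin n → Fin n → Bool
    sym   : ∀ i j → adj i j ≡ adj j i
    irrfl : ∀ i → adj i i ≡ false
open Graph public

adjK1 : ∀ {n} → (Fin n → Fin n → Bool) → Fin (suc n) → Fin (suc n) → Bool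
adjK1 a zero    zero    = false
adjK1 a zero    (suc j) = false
adjK1 a (suc i) zero    = false
adjK1 a (suc i) (suc j) = a i j

_∪K₁ : Graph → Graph
G ∪K₁ = record
  { n = suc (n G) ; adj = adjK1 (adj G) ; sym = s ; irrfl = r }
  where
  s : ∀ i j → adjK1 (adj G) i j ≡ adjK1 (adj G) j i
  s zero zero = refl
  s zero (suc j) = refl
  s (suc i) zero = refl
  s (suc i) (suc j) = Graph.sym G i j
  r : ∀ i → adjK1 (adj G) i i ≡ false
  r zero = refl
  r (suc i) = irrfl G i

adjC : ∀ {n} → (Fin n → Fin n → Bool) → Fin n → Fin n → Bool
adjC a i j = not ⌊ i ≟ j ⌋ ∧ not (a i j)

complement : Graph → Graph
complement G = record
  { n = n G ; adj = adjC (adj G) ; sym = s ; irrfl = r }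
  where
  eqsym : ∀ {m} (i j : Fin m) → ⌊ i ≟ j ⌋ ≡ ⌊ j ≟ i ⌋
  eqsym i j with i ≟ j | j ≟ i
  ... | yes _ | yes _ = refl
  ... | no _ | no _ = refl
  ... | yes p | no q = ⊥-elim (q (≡-sym p))
  ... | no p | yes q = ⊥-elim (p (≡-sym q))
  s : ∀ i j → adjC (adj G) i j ≡ adjC (adj G) j i
  s i j = cong₂ (λ x y → not x ∧ not y) (eqsym i j) (Graph.sym G i j)
  r : ∀ i → adjC (adj G) i i ≡ false
  r i with i ≟ i
  ... | yes _ = refl
  ... | no ¬p = ⊥-elim (¬p refl)

∑ : ∀ {n} → (Fin n → ℕ) → ℕ
∑ {zero}  f = 0
∑ {suc n} f = f zero + ∑ (λ i → f (suc i))

𝟙 : Bool → ℕ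
𝟙 b = if b then 1 else 0

-- Matrices over Z_ℓ (entries given as naturals, read mod ℓ).
Matrix : ℕ → Set
Matrix n = Fin n → Fin n → ℕ

A-mat : (G : Graph) → Matrix (n G)
A-mat G i j = 𝟙 (adj G i j)

N-mat : (G : Graph) → Matrix (n G)
N-mat G i j = 𝟙 (⌊ i ≟ j ⌋) + 𝟙 (adj G i j)

-- The M-Lights Out game over Z_ℓ, starting at labeling b, is winnable iff
-- some toggle counts x (toggling v_j x_j times) bring all labels to 0 mod ℓ.
-- (The order of toggles is irrelevant since the effects add up.)
Winnable : (ℓ : ℕ) {n : ℕ} → Matrix n → (Fin n → Fin ℓ) → Set
Winnable ℓ {n} M b =
  Σ (Fin n → ℕ) λ x → ∀ i → ℓ ∣ (toℕ (b i) + ∑ (λ j → M i j * x j))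

AlwaysWinnable : (ℓ : ℕ) {n : ℕ} → Matrix n → Set
AlwaysWinnable ℓ {n} M = (b : Fin n → Fin ℓ) → Winnable ℓ M b

N-AW : ℕ → Graph → Set
N-AW ℓ G = AlwaysWinnable ℓ (N-mat G)

A-AW : ℕ → Graph → Set
A-AW ℓ G = AlwaysWinnable ℓ (A-mat G)

-- Write H for the complement of G ∪ K₁, with the new vertex as 0. Every entry of row 0
-- of N(H) is 1, and off row 0 the entries of N(H) and A(G) add up to 1 (diagonal
-- included, as G is loopless). So for toggles x, with y the toggles off vertex 0,
-- every row of N(H) x equals Σx minus the corresponding row of A(G) y, and row 0 is Σx.
-- A labelling c of G is cleared by y exactly when the labelling b of H with
-- b₀ − bᵢ ≡ cᵢ is cleared by x, where x₀ ≡ −b₀ − Σy; this transfers winnability both ways.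
module Submission where

open import Defs hiding (sym)
open import Data.Nat using (ℕ; _≤_; zero; suc; _+_; _*_; s≤s; _/_)
open import Data.Nat.Properties using (+-comm; +-assoc; *-identityˡ; *-distribʳ-+)
open import Data.Nat.DivMod using (_mod_; _divMod_; DivMod)
open import Data.Nat.Divisibility using (_∣_; ∣m+n∣m⇒∣n; ∣m∣n⇒∣m+n; m∣m*n; n∣m*n)
open import Data.Nat.Tactic.RingSolver using (solve-∀)
open import Data.Fin using (Fin; zero; suc; toℕ; _≟_)
open import Data.Bool using (true; false)
open import Data.Product using (_×_; _,_; proj₁; proj₂)
open import Function using (_∘_)
open import Relation.Nullary.Decidable using (yes; no)
open import Relation.Binary.PropositionalEquality
  using (_≡_; refl; sym; trans; cong; cong₂; subst; module ≡-Reasoning)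

infixl 7 _·_

_·_ : ∀ {n} → Matrix n → (Fin n → ℕ) → Fin n → ℕ
(M · x) i = ∑ (λ j → M i j * x j)

∑-cong : ∀ {n} {f g : Fin n → ℕ} → (∀ i → f i ≡ g i) → ∑ f ≡ ∑ g
∑-cong {zero}  f≡g = refl
∑-cong {suc n} f≡g = cong₂ _+_ (f≡g zero) (∑-cong (f≡g ∘ suc))

∑-distrib-+ : ∀ {n} (f g : Fin n → ℕ) → ∑ (λ i → f i + g i) ≡ ∑ f + ∑ g
∑-distrib-+ {zero}  f g = refl
∑-distrib-+ {suc n} f g = begin
  (f zero + g zero) + ∑ (λ i → f (suc i) + g (suc i))
    ≡⟨ cong ((f zero + g zero) +_) (∑-distrib-+ (f ∘ suc) (g ∘ suc)) ⟩
  (f zero + g zero) + (∑ (f ∘ suc) + ∑ (g ∘ suc))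
    ≡⟨ interchange (f zero) (g zero) _ _ ⟩
  (f zero + ∑ (f ∘ suc)) + (g zero + ∑ (g ∘ suc)) ∎
  where
  open ≡-Reasoning
  interchange : ∀ a b c d → (a + b) + (c + d) ≡ (a + c) + (b + d)
  interchange = solve-∀

∑-*-ones : ∀ {n} (f x : Fin n → ℕ) → (∀ j → f j ≡ 1) →
           ∑ (λ j → f j * x j) ≡ ∑ x
∑-*-ones f x f≡1 = ∑-cong λ j → trans (cong (_* x j) (f≡1 j)) (*-identityˡ (x j))

∑-*-complementary : ∀ {n} (f g x : Fin n → ℕ) → (∀ j → f j + g j ≡ 1) →
                    ∑ (λ j → f j * x j) + ∑ (λ j → g j * x j) ≡ ∑ x
∑-*-complementary f g x f+g≡1 = begin
  ∑ (λ j → f j * x j) + ∑ (λ j → g j * x j)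
    ≡⟨ sym (∑-distrib-+ (λ j → f j * x j) (λ j → g j * x j)) ⟩
  ∑ (λ j → f j * x j + g j * x j)
    ≡⟨ ∑-cong (λ j → sym (*-distribʳ-+ (x j) (f j) (g j))) ⟩
  ∑ (λ j → (f j + g j) * x j)
    ≡⟨ ∑-*-ones (λ j → f j + g j) x f+g≡1 ⟩
  ∑ x ∎
  where open ≡-Reasoning

N-complement+A≡1 : (G : Graph) (i j : Fin (n G)) →
                   N-mat (complement G) i j + A-mat G i j ≡ 1
N-complement+A≡1 G i j with i ≟ j
... | yes refl rewrite irrfl G i = refl
... | no _ with adj G i j
...   | true  = refl
...   | false = refl

module _ (G : Graph) where

  private
    H : Graph
    H = complement (G ∪K₁)

  N-complement-∪K₁-row-zero : (x : Fin (n H) → ℕ) → (N-mat H · x) zero ≡ ∑ x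
  N-complement-∪K₁-row-zero x = ∑-*-ones (N-mat H zero) x entry≡1
    where
    entry≡1 : ∀ j → N-mat H zero j ≡ 1
    entry≡1 zero    = refl
    entry≡1 (suc j) = refl

  N-complement-∪K₁-row-suc : (x : Fin (n H) → ℕ) (i : Fin (n G)) →
                             (N-mat H · x) (suc i) + (A-mat G · (x ∘ suc)) i ≡ ∑ x
  N-complement-∪K₁-row-suc x i = begin
    (1 * x zero + T) + U  ≡⟨ +-assoc (1 * x zero) T U ⟩
    1 * x zero + (T + U)  ≡⟨ cong₂ _+_ (*-identityˡ (x zero)) T+U≡∑ ⟩
    x zero + ∑ (x ∘ suc)  ∎
    where
    open ≡-Reasoning
    T = ∑ (λ j → N-mat H (suc i) (suc j) * x (suc j))
    U = (A-mat G · (x ∘ suc)) i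
    T+U≡∑ : T + U ≡ ∑ (x ∘ suc)
    T+U≡∑ = ∑-*-complementary (λ j → N-mat H (suc i) (suc j)) (λ j → A-mat G i j)
              (x ∘ suc) (λ j → N-complement+A≡1 (G ∪K₁) (suc i) (suc j))

-- k is −1 modulo suc k.
negateMod : (k m : ℕ) → Fin (suc k)
negateMod k m = (k * m) mod suc k

+-negateMod : ∀ k m → suc k ∣ m + toℕ (negateMod k m)
+-negateMod k m = ∣m+n∣m⇒∣n (subst (suc k ∣_) km+m≡ (m∣m*n m)) (n∣m*n q)
  where
  q = k * m / suc k
  km+m≡ : suc k * m ≡ q * suc k + (m + toℕ (negateMod k m))
  km+m≡ = begin
    m + k * m                              ≡⟨ cong (m +_) (DivMod.property (k * m divMod suc k)) ⟩
    m + (toℕ (negateMod k m) + q * suc k)  ≡⟨ rearrange m (toℕ (negateMod k m)) (q * suc k) ⟩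
    q * suc k + (m + toℕ (negateMod k m))  ∎
    where
    open ≡-Reasoning
    rearrange : ∀ a b c → a + (b + c) ≡ c + (a + b)
    rearrange = solve-∀

∣-cancel-balanced : ∀ {d a b c e} → a + b ≡ c + e → d ∣ b → d ∣ c → d ∣ e → d ∣ a
∣-cancel-balanced {d} {a} {b} a+b≡c+e d∣b d∣c d∣e =
  ∣m+n∣m⇒∣n (subst (d ∣_) (trans (sym a+b≡c+e) (+-comm a b)) (∣m∣n⇒∣m+n d∣c d∣e)) d∣b

A-AW⇒N-AW-complement-∪K₁ : (G : Graph) (k : ℕ) →
                           A-AW (suc k) G → N-AW (suc k) (complement (G ∪K₁))
A-AW⇒N-AW-complement-∪K₁ G k aw b = x , clears
  where
  N = N-mat (complement (G ∪K₁))
  b₀ = toℕ (b zero)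
  -b₀ = toℕ (negateMod k b₀)
  c : Fin (n G) → Fin (suc k)
  c i = negateMod k (toℕ (b (suc i)) + -b₀)
  y = proj₁ (aw c)
  x : Fin (suc (n G)) → ℕ
  x zero    = toℕ (negateMod k (b₀ + ∑ y))
  x (suc j) = y j

  clears-row : ∀ {ℓ bᵢ R cᵢ U} → ℓ ∣ cᵢ + U → ℓ ∣ bᵢ + -b₀ + cᵢ → ℓ ∣ b₀ + -b₀ →
               ℓ ∣ b₀ + (R + U) → ℓ ∣ bᵢ + R
  clears-row {bᵢ = bᵢ} {R} {cᵢ} {U} ℓ∣cᵢ+U ℓ∣bᵢ-b₀+cᵢ ℓ∣b₀-b₀ =
    ∣-cancel-balanced (rearrange bᵢ R cᵢ U b₀ -b₀)
                      (∣m∣n⇒∣m+n ℓ∣cᵢ+U ℓ∣b₀-b₀) ℓ∣bᵢ-b₀+cᵢ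
    where
    rearrange : ∀ bᵢ R cᵢ U b₀ -b₀ →
                (bᵢ + R) + ((cᵢ + U) + (b₀ + -b₀)) ≡ (bᵢ + -b₀ + cᵢ) + (b₀ + (R + U))
    rearrange = solve-∀

  clears : ∀ i → suc k ∣ toℕ (b i) + (N · x) i
  clears zero = subst (suc k ∣_) (sym b₀+row≡) (+-negateMod k (b₀ + ∑ y))
    where
    open ≡-Reasoning
    rearrange : ∀ a b c → a + (b + c) ≡ (a + c) + b
    rearrange = solve-∀
    b₀+row≡ : b₀ + (N · x) zero ≡ (b₀ + ∑ y) + x zero
    b₀+row≡ = begin
      b₀ + (N · x) zero    ≡⟨ cong (b₀ +_) (N-complement-∪K₁-row-zero G x) ⟩
      b₀ + (x zero + ∑ y)  ≡⟨ rearrange b₀ (x zero) (∑ y) ⟩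
      (b₀ + ∑ y) + x zero  ∎
  clears (suc i) =
    clears-row {R = (N · x) (suc i)} (proj₂ (aw c) i)
      (+-negateMod k (toℕ (b (suc i)) + -b₀)) (+-negateMod k b₀)
      (subst (λ s → suc k ∣ b₀ + s)
             (trans (N-complement-∪K₁-row-zero G x) (sym (N-complement-∪K₁-row-suc G x i)))
             (clears zero))

N-AW-complement-∪K₁⇒A-AW : (G : Graph) (k : ℕ) →
                           N-AW (suc k) (complement (G ∪K₁)) → A-AW (suc k) G
N-AW-complement-∪K₁⇒A-AW G k nw c = x ∘ suc , clears
  where
  N = N-mat (complement (G ∪K₁))
  b : Fin (suc (n G)) → Fin (suc k)
  b zero    = zero
  b (suc i) = negateMod k (toℕ (c i))
  x = proj₁ (nw b)

  clears-row : ∀ {ℓ cᵢ bᵢ R U} → ℓ ∣ bᵢ + R → ℓ ∣ cᵢ + bᵢ → ℓ ∣ R + U → ℓ ∣ cᵢ + U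
  clears-row {cᵢ = cᵢ} {bᵢ} {R} {U} = ∣-cancel-balanced (rearrange cᵢ U bᵢ R)
    where
    rearrange : ∀ cᵢ U bᵢ R → (cᵢ + U) + (bᵢ + R) ≡ (cᵢ + bᵢ) + (R + U)
    rearrange = solve-∀

  clears : ∀ i → suc k ∣ toℕ (c i) + (A-mat G · (x ∘ suc)) i
  clears i =
    clears-row {R = (N · x) (suc i)} (proj₂ (nw b) (suc i)) (+-negateMod k (toℕ (c i)))
      (subst (suc k ∣_)
             (trans (N-complement-∪K₁-row-zero G x) (sym (N-complement-∪K₁-row-suc G x i)))
             (proj₂ (nw b) zero))

theorem2p6 : (G : Graph) (ℓ : ℕ) → 2 ≤ ℓ →
    (N-AW ℓ (complement (G ∪K₁)) → A-AW ℓ G) × (A-AW ℓ G → N-AW ℓ (complement (G ∪K₁)))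
theorem2p6 G (suc k) (s≤s _) = N-AW-complement-∪K₁⇒A-AW G k , A-AW⇒N-AW-complement-∪K₁ G k
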